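{- Let $\Gamma$ be a distance-regular graph with diameter $D \geq 3$ and valency $k$, and let $\theta \neq k$ be an eigenvalue of $\Gamma$. Then $\theta$ is of classical $(-1)$-type if and only if $\theta = -k$ and $\Gamma$ is bipartite.
   Context: A connected graph $\Gamma$ of diameter $D$ is distance-regular if for all vertices $x,y$ at distance $h$ the number $p^h_{ij}$ of vertices $z$ with $d(x,z)=i$, $d(y,z)=j$ depends only on $h,i,j$. Write $c_i = p^i_{1,i-1}$, $a_i = p^i_{1,i}$, $b_i = p^i_{1,i+1}$, $k=b_0$. The standard sequence $(u_i)_{i=0}^D$ of an eigenvalue $\theta$ is defined by $u_0=1$, $u_1=\theta/k$, and $c_iu_{i-1}+a_iu_i+b_iu_{i+1}=\theta u_i$ for $1\le i\le D-1$. The eigenvalue $\theta\ne k$ is of classical $q$-type ($q\ne 0$) if there is a real $c$ with $u_i = \frac1q u_{i-1}+c$ for $i=1,\dots,D$. -}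

module Defs where

open import Level using (Level; _⊔_)
open import Data.Nat using (ℕ; zero; suc; _≤_; _∸_) renaming (_+_ to _+ℕ_)
open import Data.Fin using (Fin; zero; suc)
open import Data.Fin.Properties using (_≟_)
open import Data.Bool using (Bool; true; false; _∧_; _∨_; not; if_then_else_)
open import Data.Product using (Σ; ∃; _×_; _,_)
open import Relation.Nullary using (¬_)
open import Relation.Nullary.Decidable using (⌊_⌋)
open import Relation.Binary.PropositionalEquality using (_≡_)
open import Algebra.Bundles using (CommutativeRing)

record Graph (n : ℕ) : Set where
  field
    adj     : Fin n → Fin n → Bool
    symm    : ∀ x y → adj x y ≡ adj y x
    irrefl  : ∀ x → adj x x ≡ false

anyF : ∀ {n} → (Fin n → Bool) → Bool
anyF {zero}  f = false
anyF {suc n} f = f zero ∨ anyF (λ i → f (suc i))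

countF : ∀ {n} → (Fin n → Bool) → ℕ
countF {zero}  f = 0
countF {suc n} f = (if f zero then 1 else 0) +ℕ countF (λ i → f (suc i))

module _ {n : ℕ} (Γ : Graph n) where
  open Graph Γ

  walkLe : ℕ → Fin n → Fin n → Bool
  walkLe zero    x y = ⌊ x ≟ y ⌋
  walkLe (suc m) x y = walkLe m x y ∨ anyF (λ z → adj x z ∧ walkLe m z y)

  distIs : ℕ → Fin n → Fin n → Bool
  distIs zero    x y = walkLe zero x y
  distIs (suc i) x y = walkLe (suc i) x y ∧ not (walkLe i x y)

  HasDiameter : ℕ → Set
  HasDiameter D = (∀ x y → walkLe D x y ≡ true)
                × ∃ λ x → ∃ λ y → distIs D x y ≡ true

  IsIntersectionNumbers : (ℕ → ℕ → ℕ → ℕ) → Set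
  IsIntersectionNumbers p =
    ∀ h i j x y → distIs h x y ≡ true →
      countF (λ z → distIs i x z ∧ distIs j y z) ≡ p h i j

  IsDistanceRegular : ℕ → (ℕ → ℕ → ℕ → ℕ) → Set
  IsDistanceRegular D p = HasDiameter D × IsIntersectionNumbers p

  Bipartite : Set
  Bipartite = ∃ λ (col : Fin n → Bool) →
    ∀ x y → adj x y ≡ true → ¬ (col x ≡ col y)

module _ (p : ℕ → ℕ → ℕ → ℕ) where
  cᵢ aᵢ bᵢ : ℕ → ℕ
  cᵢ i = p i 1 (i ∸ 1)
  aᵢ i = p i 1 i
  bᵢ i = p i 1 (suc i)

  valency : ℕ
  valency = bᵢ 0

module _ {c ℓ : Level} (F : CommutativeRing c ℓ) where
  open CommutativeRing F using (Carrier; _≈_; _+_; _*_; -_; 0#; 1#)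

  fromℕ : ℕ → Carrier
  fromℕ zero    = 0#
  fromℕ (suc m) = 1# + fromℕ m

  IsFieldChar0 : Set (c ⊔ ℓ)
  IsFieldChar0 = (¬ (1# ≈ 0#))
               × (∀ x → ¬ (x ≈ 0#) → ∃ λ y → (x * y) ≈ 1#)
               × (∀ m → fromℕ m ≈ 0# → m ≡ 0)

  sumF : ∀ {n} → (Fin n → Carrier) → Carrier
  sumF {zero}  f = 0#
  sumF {suc n} f = f zero + sumF (λ i → f (suc i))

  IsEigenvalue : ∀ {n} → Graph n → Carrier → Set (c ⊔ ℓ)
  IsEigenvalue {n} Γ θ = ∃ λ (v : Fin n → Carrier) →
      (∃ λ x → ¬ (v x ≈ 0#))
    × (∀ x → sumF (λ y → if Graph.adj Γ x y then v y else 0#) ≈ θ * v x)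

  IsStandardSequence : ℕ → (ℕ → ℕ → ℕ → ℕ) → Carrier → (ℕ → Carrier) → Set ℓ
  IsStandardSequence D p θ u =
      (u 0 ≈ 1#)
    × (fromℕ (valency p) * u 1 ≈ θ)
    × (∀ i → 1 ≤ i → suc i ≤ D →
         fromℕ (cᵢ p i) * u (i ∸ 1) + fromℕ (aᵢ p i) * u i
           + fromℕ (bᵢ p i) * u (suc i) ≈ θ * u i)

  -- θ is of classical q-type, with q given through its inverse q⁻¹
  -- (u_i = q⁻¹ u_{i-1} + c for i = 1..D, u the standard sequence of θ)
  ClassicalTypeInv : ℕ → (ℕ → ℕ → ℕ → ℕ) → Carrier → Carrier → Set (c ⊔ ℓ)
  ClassicalTypeInv D p qinv θ =
    ∀ u → IsStandardSequence D p θ u →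
      ∃ λ cc → ∀ i → 1 ≤ i → i ≤ D → u i ≈ qinv * u (i ∸ 1) + cc

  ClassicalMinusOneType : ℕ → (ℕ → ℕ → ℕ → ℕ) → Carrier → Set (c ⊔ ℓ)
  ClassicalMinusOneType D p θ = ClassicalTypeInv D p (- 1#) θ

-- If u i = - u (i - 1) + γ, the standard sequence reads 1, u₁, 1, u₁, … . The recurrence at i = 2
-- gives a₂ (1 - u₁) = 0, and u₁ ≠ 1 because θ ≠ k, so a₂ = 0 and hence a₁ = 0 (D ≥ 3). The recurrence
-- at i = 1 then gives u₁² = 1, so u₁ = -1, θ = -k and u i = (-1)^i, which forces a i = 0 for i < D.
-- For a_D, pair an eigenvector v with the signs (-1)^d(x,z): as θ = -k, this leaves
-- 2 a_D (-1)^D Σ_{d(x,z)=D} v z = 0, and if a_D ≠ 0 the three-term recurrence of the layer sums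
-- of v carries the vanishing down to v x = 0. Finally Γ is bipartite iff every a i = 0 (colour by the
-- parity of the distance to a fixed vertex), and then θ = -k makes u i = (-1)^i, which is of (-1)-type.

module Submission where

open import Level using (Level)
open import Algebra.Bundles using (CommutativeRing)
open import Data.Bool using (Bool; true; false; _∧_; _∨_; not; if_then_else_)
open import Data.Empty using (⊥-elim)
open import Data.Fin using (Fin; zero; suc)
open import Data.Fin.Properties using (_≟_; suc-injective)
open import Data.Integer as ℤ using (ℤ; +_; -[1+_])
import Data.Integer.Properties as ℤ
open import Data.Maybe using (Maybe; just; nothing)
open import Data.Nat as ℕ using (ℕ; zero; suc; _≤_; _<_; z≤n; s≤s; _∸_; _≡ᵇ_)
import Data.Nat.Properties as ℕ
open import Data.Product using (∃; _×_; _,_; proj₁; proj₂)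
open import Data.Sign as Sign using (Sign)
open import Data.Sum using (_⊎_; inj₁; inj₂)
open import Function using (_∘_)
open import Function.Bundles using (_⇔_; mk⇔)
open import Relation.Nullary using (¬_; yes; no)
import Relation.Binary.PropositionalEquality as ≡
open ≡ using (_≡_)
import Algebra.Solver.Ring.AlmostCommutativeRing as ACR

open import Defs

-- The ring solver needs a concrete coefficient ring with decidable equality; ℤ maps into every ring.
module IntegerCoefficients {ℓ₁ ℓ₂ : Level} (R : CommutativeRing ℓ₁ ℓ₂) where
  open CommutativeRing R hiding (zero)
  open import Algebra.Properties.Ring ring
  open import Relation.Binary.Reasoning.Setoid setoid

  fromℕ-+ : ∀ m n → fromℕ R (m ℕ.+ n) ≈ fromℕ R m + fromℕ R n
  fromℕ-+ zero    n = sym (+-identityˡ _)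
  fromℕ-+ (suc m) n = trans (+-congˡ (fromℕ-+ m n)) (sym (+-assoc _ _ _))

  fromℕ-* : ∀ m n → fromℕ R (m ℕ.* n) ≈ fromℕ R m * fromℕ R n
  fromℕ-* zero    n = sym (zeroˡ _)
  fromℕ-* (suc m) n = begin
    fromℕ R (n ℕ.+ m ℕ.* n)              ≈⟨ fromℕ-+ n (m ℕ.* n) ⟩
    fromℕ R n + fromℕ R (m ℕ.* n)        ≈⟨ +-cong (sym (*-identityˡ _)) (fromℕ-* m n) ⟩
    1# * fromℕ R n + fromℕ R m * fromℕ R n ≈⟨ sym (distribʳ _ _ _) ⟩
    (1# + fromℕ R m) * fromℕ R n         ∎

  fromSign : Sign → Carrier
  fromSign Sign.+ = 1#
  fromSign Sign.- = - 1#

  fromSign-* : ∀ s t → fromSign (s Sign.* t) ≈ fromSign s * fromSign t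
  fromSign-* Sign.- Sign.- = sym (trans (-1*x≈-x (- 1#)) (-‿involutive 1#))
  fromSign-* Sign.- Sign.+ = sym (*-identityʳ _)
  fromSign-* Sign.+ Sign.- = sym (*-identityˡ _)
  fromSign-* Sign.+ Sign.+ = sym (*-identityˡ _)

  fromℤ : ℤ → Carrier
  fromℤ (+ n)      = fromℕ R n
  fromℤ -[1+ n ]   = - fromℕ R (suc n)

  fromℤ-◃ : ∀ s n → fromℤ (s ℤ.◃ n) ≈ fromSign s * fromℕ R n
  fromℤ-◃ s       zero    = sym (zeroʳ _)
  fromℤ-◃ Sign.+ (suc n) = sym (*-identityˡ _)
  fromℤ-◃ Sign.- (suc n) = sym (-1*x≈-x _)

  fromℤ-sign-abs : ∀ i → fromℤ i ≈ fromSign (ℤ.sign i) * fromℕ R ℤ.∣ i ∣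
  fromℤ-sign-abs i = trans (reflexive (≡.cong fromℤ (≡.sym (ℤ.◃-inverse i))))
                           (fromℤ-◃ (ℤ.sign i) ℤ.∣ i ∣)

  fromℤ-‿ : ∀ i → fromℤ (ℤ.- i) ≈ - fromℤ i
  fromℤ-‿ (+ zero)  = sym -0#≈0#
  fromℤ-‿ (+ suc n) = refl
  fromℤ-‿ -[1+ n ]  = sym (-‿involutive _)

  fromℤ-⊖ : ∀ m n → fromℤ (m ℤ.⊖ n) ≈ fromℕ R m - fromℕ R n
  fromℤ-⊖ zero    zero    = sym (trans (+-congˡ -0#≈0#) (+-identityʳ _))
  fromℤ-⊖ zero    (suc n) = sym (+-identityˡ _)
  fromℤ-⊖ (suc m) zero    = sym (trans (+-congˡ -0#≈0#) (+-identityʳ _))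
  fromℤ-⊖ (suc m) (suc n) = begin
    fromℤ (suc m ℤ.⊖ suc n)             ≈⟨ reflexive (≡.cong fromℤ (ℤ.[1+m]⊖[1+n]≡m⊖n m n)) ⟩
    fromℤ (m ℤ.⊖ n)                     ≈⟨ fromℤ-⊖ m n ⟩
    fromℕ R m - fromℕ R n               ≈⟨ sym ([x+y]-[x+z]≈y-z 1# _ _) ⟩
    (1# + fromℕ R m) - (1# + fromℕ R n) ∎
    where
    [x+y]-[x+z]≈y-z : ∀ x y z → (x + y) - (x + z) ≈ y - z
    [x+y]-[x+z]≈y-z x y z = begin
      (x + y) - (x + z)     ≈⟨ +-congˡ (sym (-‿+-comm x z)) ⟩
      (x + y) + (- x + - z) ≈⟨ +-assoc x y _ ⟩
      x + (y + (- x + - z)) ≈⟨ +-congˡ (sym (+-assoc y _ _)) ⟩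
      x + ((y + - x) + - z) ≈⟨ +-congˡ (+-congʳ (+-comm y _)) ⟩
      x + ((- x + y) + - z) ≈⟨ +-congˡ (+-assoc _ y _) ⟩
      x + (- x + (y - z))   ≈⟨ sym (+-assoc x _ _) ⟩
      (x + - x) + (y - z)   ≈⟨ +-congʳ (-‿inverseʳ x) ⟩
      0# + (y - z)          ≈⟨ +-identityˡ _ ⟩
      y - z                 ∎

  fromℤ-+ : ∀ i j → fromℤ (i ℤ.+ j) ≈ fromℤ i + fromℤ j
  fromℤ-+ -[1+ m ] -[1+ n ] = begin
    - fromℕ R (suc (suc (m ℕ.+ n)))       ≈⟨ -‿cong (reflexive (≡.cong (fromℕ R ∘ suc) (≡.sym (ℕ.+-suc m n)))) ⟩
    - fromℕ R (suc m ℕ.+ suc n)           ≈⟨ -‿cong (fromℕ-+ (suc m) (suc n)) ⟩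
    - (fromℕ R (suc m) + fromℕ R (suc n)) ≈⟨ sym (-‿+-comm _ _) ⟩
    - fromℕ R (suc m) + - fromℕ R (suc n) ∎
  fromℤ-+ -[1+ m ] (+ n)    = trans (fromℤ-⊖ n (suc m)) (+-comm _ _)
  fromℤ-+ (+ m)    -[1+ n ] = fromℤ-⊖ m (suc n)
  fromℤ-+ (+ m)    (+ n)    = fromℕ-+ m n

  fromℤ-* : ∀ i j → fromℤ (i ℤ.* j) ≈ fromℤ i * fromℤ j
  fromℤ-* i j = begin
    fromℤ (i ℤ.* j)
      ≈⟨ fromℤ-◃ (s i Sign.* s j) (ℤ.∣ i ∣ ℕ.* ℤ.∣ j ∣) ⟩
    fromSign (s i Sign.* s j) * fromℕ R (ℤ.∣ i ∣ ℕ.* ℤ.∣ j ∣)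
      ≈⟨ *-cong (fromSign-* (s i) (s j)) (fromℕ-* ℤ.∣ i ∣ ℤ.∣ j ∣) ⟩
    (fromSign (s i) * fromSign (s j)) * (fromℕ R ℤ.∣ i ∣ * fromℕ R ℤ.∣ j ∣)
      ≈⟨ interchange _ _ _ _ ⟩
    (fromSign (s i) * fromℕ R ℤ.∣ i ∣) * (fromSign (s j) * fromℕ R ℤ.∣ j ∣)
      ≈⟨ *-cong (sym (fromℤ-sign-abs i)) (sym (fromℤ-sign-abs j)) ⟩
    fromℤ i * fromℤ j
      ∎
    where
    s : ℤ → Sign
    s = ℤ.sign
    interchange : ∀ a b c d → (a * b) * (c * d) ≈ (a * c) * (b * d)
    interchange a b c d = begin
      (a * b) * (c * d) ≈⟨ *-assoc a b _ ⟩
      a * (b * (c * d)) ≈⟨ *-congˡ (sym (*-assoc b c d)) ⟩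
      a * ((b * c) * d) ≈⟨ *-congˡ (*-congʳ (*-comm b c)) ⟩
      a * ((c * b) * d) ≈⟨ *-congˡ (*-assoc c b d) ⟩
      a * (c * (b * d)) ≈⟨ sym (*-assoc a c _) ⟩
      (a * c) * (b * d) ∎

  fromℤ-homomorphism : ℤ.+-*-rawRing ACR.-Raw-AlmostCommutative⟶ ACR.fromCommutativeRing R
  fromℤ-homomorphism = record
    { ⟦_⟧    = fromℤ
    ; +-homo = fromℤ-+
    ; *-homo = fromℤ-*
    ; -‿homo = fromℤ-‿
    ; 0-homo = refl
    ; 1-homo = +-identityʳ 1#
    }

  fromℤ-≈? : ∀ i j → Maybe (fromℤ i ≈ fromℤ j)
  fromℤ-≈? i j with i ℤ.≟ j
  ... | yes ≡.refl = just refl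
  ... | no _     = nothing

  open import Algebra.Solver.Ring ℤ.+-*-rawRing (ACR.fromCommutativeRing R) fromℤ-homomorphism fromℤ-≈? public
    using (solve; _:=_; _:+_; _:*_; :-_; _:-_; con)

module Counting where
  open ≡ using (refl; sym; trans; cong; cong₂)
  open import Algebra.Properties.CommutativeSemigroup ℕ.+-commutativeSemigroup using (interchange)

  ∨-true : ∀ {a b} → a ∨ b ≡ true → a ≡ true ⊎ b ≡ true
  ∨-true {true}  _ = inj₁ refl
  ∨-true {false} e = inj₂ e

  ∧-true : ∀ {a b} → a ∧ b ≡ true → a ≡ true × b ≡ true
  ∧-true {true} {true} _ = refl , refl

  ∧-intro : ∀ {a b} → a ≡ true → b ≡ true → a ∧ b ≡ true
  ∧-intro refl refl = refl

  ∨-introˡ : ∀ {a} b → a ≡ true → a ∨ b ≡ true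
  ∨-introˡ _ refl = refl

  ∨-introʳ : ∀ a {b} → b ≡ true → a ∨ b ≡ true
  ∨-introʳ true  _ = refl
  ∨-introʳ false e = e

  true≢false : ¬ (true ≡ false)
  true≢false ()

  ≡ᵇ-true⇒≡ : ∀ {m n} → (m ≡ᵇ n) ≡ true → m ≡ n
  ≡ᵇ-true⇒≡ {m} {n} e = ℕ.≡ᵇ⇒≡ m n (≡.subst Data.Bool.T (sym e) _)

  ≡⇒≡ᵇ-true : ∀ {m n} → m ≡ n → (m ≡ᵇ n) ≡ true
  ≡⇒≡ᵇ-true {zero}  refl = refl
  ≡⇒≡ᵇ-true {suc m} refl = ≡⇒≡ᵇ-true {m} refl

  ≡ᵇ-false⇒≢ : ∀ {m n} → (m ≡ᵇ n) ≡ false → ¬ (m ≡ n)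
  ≡ᵇ-false⇒≢ e m≡n = true≢false (trans (sym (≡⇒≡ᵇ-true m≡n)) e)

  ≢⇒≡ᵇ-false : ∀ {m n} → ¬ (m ≡ n) → (m ≡ᵇ n) ≡ false
  ≢⇒≡ᵇ-false {m} {n} m≢n with m ≡ᵇ n in e
  ... | true  = ⊥-elim (m≢n (≡ᵇ-true⇒≡ e))
  ... | false = refl

  anyF-witness : ∀ {m} (f : Fin m → Bool) → anyF f ≡ true → ∃ λ i → f i ≡ true
  anyF-witness {suc m} f e with ∨-true {f zero} e
  ... | inj₁ e₀ = zero , e₀
  ... | inj₂ e₁ with anyF-witness (λ i → f (suc i)) e₁
  ... | i , eᵢ = suc i , eᵢ

  anyF-intro : ∀ {m} (f : Fin m → Bool) i → f i ≡ true → anyF f ≡ true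
  anyF-intro f zero    e = ∨-introˡ _ e
  anyF-intro f (suc i) e = ∨-introʳ (f zero) (anyF-intro (λ j → f (suc j)) i e)

  indicator : Bool → ℕ
  indicator b = if b then 1 else 0

  countF-cong : ∀ {m} {f g : Fin m → Bool} → (∀ z → f z ≡ g z) → countF f ≡ countF g
  countF-cong {zero}  e = refl
  countF-cong {suc m} e = cong₂ ℕ._+_ (cong indicator (e zero)) (countF-cong (λ i → e (suc i)))

  countF-+ : ∀ {m} (f g h : Fin m → Bool) →
    (∀ z → indicator (f z) ≡ indicator (g z) ℕ.+ indicator (h z)) →
    countF f ≡ countF g ℕ.+ countF h
  countF-+ {zero}  f g h e = refl
  countF-+ {suc m} f g h e = trans
    (cong₂ ℕ._+_ (e zero) (countF-+ (λ i → f (suc i)) (λ i → g (suc i)) (λ i → h (suc i)) (λ i → e (suc i))))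
    (interchange (indicator (g zero)) (indicator (h zero)) _ _)

  countF-+₃ : ∀ {m} (f g h l : Fin m → Bool) →
    (∀ z → indicator (f z) ≡ indicator (g z) ℕ.+ indicator (h z) ℕ.+ indicator (l z)) →
    countF f ≡ countF g ℕ.+ countF h ℕ.+ countF l
  countF-+₃ {zero}  f g h l e = refl
  countF-+₃ {suc m} f g h l e = trans
    (cong₂ ℕ._+_ (e zero) (countF-+₃ (λ i → f (suc i)) (λ i → g (suc i)) (λ i → h (suc i)) (λ i → l (suc i))
                                    (λ i → e (suc i))))
    (trans (interchange (indicator (g zero) ℕ.+ indicator (h zero)) (indicator (l zero)) _ _)
           (cong (ℕ._+ countF l) (interchange (indicator (g zero)) (indicator (h zero)) _ _)))

  countF-≥1 : ∀ {m} (f : Fin m → Bool) z → f z ≡ true → 1 ≤ countF f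
  countF-≥1 f zero e rewrite e = s≤s z≤n
  countF-≥1 {suc m} f (suc z) e =
    ℕ.≤-trans (countF-≥1 (λ i → f (suc i)) z e) (ℕ.m≤n+m _ (indicator (f zero)))

  countF-witness : ∀ {m} (f : Fin m → Bool) → 1 ≤ countF f → ∃ λ z → f z ≡ true
  countF-witness {suc m} f le with f zero in e
  ... | true  = zero , e
  ... | false with countF-witness (λ i → f (suc i)) le
  ... | z , e′ = suc z , e′

  countF-≡0 : ∀ {m} (f : Fin m → Bool) → (∀ z → f z ≡ false) → countF f ≡ 0
  countF-≡0 {zero}  f e = refl
  countF-≡0 {suc m} f e rewrite e zero = countF-≡0 (λ i → f (suc i)) (λ i → e (suc i))

module Walks {n : ℕ} (Γ : Graph n) where
  open Graph Γ
  open Counting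
  open ≡ using (refl; sym; trans; cong; subst)

  walkLe-suc : ∀ m {x y} → walkLe Γ m x y ≡ true → walkLe Γ (suc m) x y ≡ true
  walkLe-suc m e = ∨-introˡ _ e

  walkLe-mono : ∀ {m m′ x y} → m ≤ m′ → walkLe Γ m x y ≡ true → walkLe Γ m′ x y ≡ true
  walkLe-mono {m} {x = x} {y} m≤m′ e = go (ℕ.≤⇒≤′ m≤m′)
    where
    go : ∀ {m′} → m ℕ.≤′ m′ → walkLe Γ m′ x y ≡ true
    go ℕ.≤′-refl      = e
    go (ℕ.≤′-step {m′} le) = walkLe-suc m′ (go le)

  walkLe-zero⇒≡ : ∀ {x y} → walkLe Γ 0 x y ≡ true → x ≡ y
  walkLe-zero⇒≡ {x} {y} e with x ≟ y
  ... | yes x≡y = x≡y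
  ... | no  _   = ⊥-elim (true≢false (sym e))

  walkLe-refl : ∀ m x → walkLe Γ m x x ≡ true
  walkLe-refl m x = walkLe-mono {m′ = m} z≤n (walkLe-zero-refl x)
    where
    walkLe-zero-refl : ∀ x → walkLe Γ 0 x x ≡ true
    walkLe-zero-refl x with x ≟ x
    ... | yes _  = refl
    ... | no x≢x = ⊥-elim (x≢x refl)

  walkLe-cons : ∀ m {x w y} → adj x w ≡ true → walkLe Γ m w y ≡ true → walkLe Γ (suc m) x y ≡ true
  walkLe-cons m {x} {w} {y} a e =
    ∨-introʳ (walkLe Γ m x y) (anyF-intro (λ z → adj x z ∧ walkLe Γ m z y) w (∧-intro a e))

  walkLe-uncons : ∀ m {x y} → walkLe Γ (suc m) x y ≡ true →
    walkLe Γ m x y ≡ true ⊎ ∃ λ w → adj x w ≡ true × walkLe Γ m w y ≡ true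
  walkLe-uncons m {x} {y} e with ∨-true {walkLe Γ m x y} e
  ... | inj₁ e′ = inj₁ e′
  ... | inj₂ e′ with anyF-witness (λ z → adj x z ∧ walkLe Γ m z y) e′
  ... | w , e″ = inj₂ (w , ∧-true e″)

  walkLe-adj : ∀ {x y} → adj x y ≡ true → walkLe Γ 1 x y ≡ true
  walkLe-adj a = walkLe-cons 0 a (walkLe-refl 0 _)

  walkLe-trans : ∀ m l {x y z} → walkLe Γ m x y ≡ true → walkLe Γ l y z ≡ true →
                 walkLe Γ (m ℕ.+ l) x z ≡ true
  walkLe-trans zero    l e e′ with walkLe-zero⇒≡ e
  ... | refl = e′
  walkLe-trans (suc m) l e e′ with walkLe-uncons m e
  ... | inj₁ e″           = walkLe-suc (m ℕ.+ l) (walkLe-trans m l e″ e′)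
  ... | inj₂ (w , a , e″) = walkLe-cons (m ℕ.+ l) a (walkLe-trans m l e″ e′)

  walkLe-sym : ∀ m {x y} → walkLe Γ m x y ≡ true → walkLe Γ m y x ≡ true
  walkLe-sym zero e with walkLe-zero⇒≡ e
  ... | refl = e
  walkLe-sym (suc m) {x} {y} e with walkLe-uncons m e
  ... | inj₁ e′           = walkLe-suc m (walkLe-sym m e′)
  ... | inj₂ (w , a , e′) = subst (λ l → walkLe Γ l y x ≡ true) (ℕ.+-comm m 1)
      (walkLe-trans m 1 (walkLe-sym m e′) (walkLe-adj (trans (symm w x) a)))

leastTrue : (ℕ → Bool) → ℕ → ℕ
leastTrue f zero    = 0
leastTrue f (suc b) = if f 0 then 0 else suc (leastTrue (f ∘ suc) b)

leastTrue-true : ∀ (f : ℕ → Bool) b → f b ≡ true → f (leastTrue f b) ≡ true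
leastTrue-true f zero    e = e
leastTrue-true f (suc b) e with f 0 in e₀
... | true  = e₀
... | false = leastTrue-true (f ∘ suc) b e

leastTrue-least : ∀ (f : ℕ → Bool) b {m} → m < leastTrue f b → f m ≡ false
leastTrue-least f (suc b) {m} m< with f 0 in e₀
leastTrue-least f (suc b) {zero}  m<        | false = e₀
leastTrue-least f (suc b) {suc m} (s≤s m<)  | false = leastTrue-least (f ∘ suc) b m<

within-one : ∀ {a b} → a ≤ suc b → b ≤ suc a → a ≡ b ⊎ a ≡ suc b ⊎ suc a ≡ b
within-one {zero}        {zero}        _       _       = inj₁ ≡.refl
within-one {zero}        {suc zero}    _       _       = inj₂ (inj₂ ≡.refl)
within-one {suc zero}    {zero}        _       _       = inj₂ (inj₁ ≡.refl)
within-one {zero}        {suc (suc _)} _       (s≤s ())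
within-one {suc (suc _)} {zero}        (s≤s ()) _
within-one {suc a}       {suc b}       (s≤s p) (s≤s q) with within-one p q
... | inj₁ e        = inj₁ (≡.cong suc e)
... | inj₂ (inj₁ e) = inj₂ (inj₁ (≡.cong suc e))
... | inj₂ (inj₂ e) = inj₂ (inj₂ (≡.cong suc e))

module Distance {n : ℕ} (Γ : Graph n) (D : ℕ) (connected : ∀ x y → walkLe Γ D x y ≡ true) where
  open Graph Γ
  open Counting
  open Walks Γ
  open ≡ using (refl; sym; trans; cong; subst)

  dist : Fin n → Fin n → ℕ
  dist x y = leastTrue (λ m → walkLe Γ m x y) D

  dist-walkLe : ∀ x y → walkLe Γ (dist x y) x y ≡ true
  dist-walkLe x y = leastTrue-true (λ m → walkLe Γ m x y) D (connected x y)

  walkLe-<dist : ∀ {m x y} → m < dist x y → walkLe Γ m x y ≡ false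
  walkLe-<dist {x = x} {y} = leastTrue-least (λ m → walkLe Γ m x y) D

  dist-≤ : ∀ {m x y} → walkLe Γ m x y ≡ true → dist x y ≤ m
  dist-≤ {m} {x} {y} e with ℕ.≤-<-connex (dist x y) m
  ... | inj₁ le = le
  ... | inj₂ lt = ⊥-elim (true≢false (trans (sym e) (walkLe-<dist lt)))

  dist-≤D : ∀ x y → dist x y ≤ D
  dist-≤D x y = dist-≤ (connected x y)

  walkLe-dist-≡ : ∀ {m x y} → dist x y ≡ m → walkLe Γ m x y ≡ true
  walkLe-dist-≡ {x = x} {y} refl = dist-walkLe x y

  distIs-dist : ∀ x y → distIs Γ (dist x y) x y ≡ true
  distIs-dist x y with dist x y in e
  ... | zero  = walkLe-dist-≡ e
  ... | suc m = ∧-intro (walkLe-dist-≡ e) (cong not (walkLe-<dist (subst (m <_) (sym e) ℕ.≤-refl)))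

  distIs⇒dist : ∀ i {x y} → distIs Γ i x y ≡ true → dist x y ≡ i
  distIs⇒dist zero    e = ℕ.n≤0⇒n≡0 (dist-≤ e)
  distIs⇒dist (suc m) {x} {y} e with ∧-true {walkLe Γ (suc m) x y} e | ℕ.≤-<-connex (dist x y) m
  ... | e₁ , e₂ | inj₁ le = ⊥-elim (true≢false (trans (sym (walkLe-mono le (dist-walkLe x y))) (not-true e₂)))
    where
    not-true : ∀ {b} → not b ≡ true → b ≡ false
    not-true {false} _ = refl
  ... | e₁ , _  | inj₂ lt = ℕ.≤-antisym (dist-≤ e₁) lt

  distIs≡dist≡ᵇ : ∀ i x y → distIs Γ i x y ≡ (dist x y ≡ᵇ i)
  distIs≡dist≡ᵇ i x y with distIs Γ i x y in e
  ... | true  = sym (≡⇒≡ᵇ-true (distIs⇒dist i e))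
  ... | false with dist x y ≡ᵇ i in e′
  ... | false = refl
  ... | true with ≡ᵇ-true⇒≡ {dist x y} e′
  ... | refl = trans (sym e) (distIs-dist x y)

  dist-sym : ∀ x y → dist x y ≡ dist y x
  dist-sym x y = ℕ.≤-antisym (dist-≤ (walkLe-sym (dist y x) (dist-walkLe y x)))
                            (dist-≤ (walkLe-sym (dist x y) (dist-walkLe x y)))

  dist≡0⇒≡ : ∀ {x y} → dist x y ≡ 0 → x ≡ y
  dist≡0⇒≡ e = walkLe-zero⇒≡ (walkLe-dist-≡ e)

  dist-refl : ∀ x → dist x x ≡ 0
  dist-refl x = ℕ.n≤0⇒n≡0 (dist-≤ (walkLe-refl 0 x))

  dist-triangle : ∀ x y z → dist x z ≤ dist x y ℕ.+ dist y z
  dist-triangle x y z = dist-≤ (walkLe-trans (dist x y) (dist y z) (dist-walkLe x y) (dist-walkLe y z))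

  adj⇒dist≡1 : ∀ {x y} → adj x y ≡ true → dist x y ≡ 1
  adj⇒dist≡1 {x} {y} a with dist x y in e
  ... | zero        = ⊥-elim (true≢false (trans (sym a) (subst (λ w → adj x w ≡ false) (dist≡0⇒≡ e) (irrefl x))))
  ... | suc zero    = refl
  ... | suc (suc m) with subst (_≤ 1) e (dist-≤ (walkLe-adj a))
  ... | s≤s ()

  dist-step : ∀ {x y m} → dist x y ≡ suc m → ∃ λ w → adj x w ≡ true × dist w y ≡ m
  dist-step {x} {y} {m} e with walkLe-uncons m (walkLe-dist-≡ e)
  ... | inj₁ e′ = ⊥-elim (ℕ.<-irrefl refl (subst (_≤ m) e (dist-≤ e′)))
  ... | inj₂ (w , a , e′) = w , a , ℕ.≤-antisym (dist-≤ e′) (ℕ.≤-pred 1+m≤)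
    where
    1+m≤ : suc m ≤ suc (dist w y)
    1+m≤ = ≡.subst₂ _≤_ e (cong (ℕ._+ dist w y) (adj⇒dist≡1 a)) (dist-triangle x w y)

  dist≡1⇒adj : ∀ {x y} → dist x y ≡ 1 → adj x y ≡ true
  dist≡1⇒adj e with dist-step e
  ... | w , a , e′ with dist≡0⇒≡ e′
  ... | refl = a

  adj≡dist≡ᵇ1 : ∀ x y → adj x y ≡ (dist x y ≡ᵇ 1)
  adj≡dist≡ᵇ1 x y with adj x y in a
  ... | true  = sym (≡⇒≡ᵇ-true (adj⇒dist≡1 a))
  ... | false with dist x y ≡ᵇ 1 in e
  ... | true  = ⊥-elim (true≢false (trans (sym (dist≡1⇒adj (≡ᵇ-true⇒≡ e))) a))
  ... | false = refl

  dist-adj-≤ : ∀ x {y z} → adj y z ≡ true → dist x z ≤ suc (dist x y)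
  dist-adj-≤ x {y} {z} a =
    subst (dist x z ≤_) (trans (cong (dist x y ℕ.+_) (adj⇒dist≡1 a)) (ℕ.+-comm (dist x y) 1)) (dist-triangle x y z)

  dist-adj : ∀ x {y z} → adj y z ≡ true →
    dist x z ≡ dist x y ⊎ dist x z ≡ suc (dist x y) ⊎ suc (dist x z) ≡ dist x y
  dist-adj x a = within-one (dist-adj-≤ x a) (dist-adj-≤ x (trans (symm _ _) a))

indicator-one-of-three : ∀ {d} i → d ≡ i ⊎ d ≡ suc i ⊎ d ≡ suc (suc i) →
  Counting.indicator (d ≡ᵇ i) ℕ.+ Counting.indicator (d ≡ᵇ suc i) ℕ.+ Counting.indicator (d ≡ᵇ suc (suc i)) ≡ 1
indicator-one-of-three zero    (inj₁ ≡.refl)        = ≡.refl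
indicator-one-of-three zero    (inj₂ (inj₁ ≡.refl)) = ≡.refl
indicator-one-of-three zero    (inj₂ (inj₂ ≡.refl)) = ≡.refl
indicator-one-of-three (suc i) (inj₁ ≡.refl)        = indicator-one-of-three i (inj₁ ≡.refl)
indicator-one-of-three (suc i) (inj₂ (inj₁ ≡.refl)) = indicator-one-of-three i (inj₂ (inj₁ ≡.refl))
indicator-one-of-three (suc i) (inj₂ (inj₂ ≡.refl)) = indicator-one-of-three i (inj₂ (inj₂ ≡.refl))

notⁿ : ℕ → Bool → Bool
notⁿ zero    b = b
notⁿ (suc m) b = notⁿ m (not b)

notⁿ-not : ∀ m b → notⁿ m (not b) ≡ not (notⁿ m b)
notⁿ-not zero    b = ≡.refl
notⁿ-not (suc m) b = notⁿ-not m (not b)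

not-≢ : ∀ b → ¬ (not b ≡ b)
not-≢ true  ()
not-≢ false ()

module DistanceRegular {n : ℕ} (Γ : Graph n) (D : ℕ) (p : ℕ → ℕ → ℕ → ℕ)
                       (dr : IsDistanceRegular Γ D p) where
  open Graph Γ
  open Counting
  open Distance Γ D (proj₁ (proj₁ dr)) public
  open ≡ using (refl; sym; trans; cong; cong₂; subst; subst₂)
  open import Data.Bool.Properties using (∧-comm; ∧-idem)

  intersection-count : ∀ i j {x y h} → dist x y ≡ h →
    countF (λ z → (dist x z ≡ᵇ i) ∧ (dist y z ≡ᵇ j)) ≡ p h i j
  intersection-count i j {x} {y} refl =
    trans (countF-cong (λ z → sym (cong₂ _∧_ (distIs≡dist≡ᵇ i x z) (distIs≡dist≡ᵇ j y z))))
          (proj₂ dr (dist x y) i j x y (distIs-dist x y))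

  intersection-≥1 : ∀ {x y h i j} z → dist x y ≡ h → dist x z ≡ i → dist y z ≡ j → 1 ≤ p h i j
  intersection-≥1 z e e₁ e₂ =
    subst (1 ≤_) (intersection-count _ _ e) (countF-≥1 _ z (∧-intro (≡⇒≡ᵇ-true e₁) (≡⇒≡ᵇ-true e₂)))

  count-neighbours : ∀ x (g : Fin n → Bool) →
    countF (λ z → adj x z ∧ g z) ≡ countF (λ z → (dist x z ≡ᵇ 1) ∧ g z)
  count-neighbours x g = countF-cong (λ z → cong (_∧ g z) (adj≡dist≡ᵇ1 x z))

  degree : ∀ x → countF (adj x) ≡ valency p
  degree x = trans (countF-cong (λ z → trans (adj≡dist≡ᵇ1 x z) (sym (∧-idem _))))
                   (intersection-count 1 1 (dist-refl x))

  dist-realised-below : ∀ {x y m} t → dist x y ≡ t → m ≤ t → ∃ λ a → ∃ λ b → dist a b ≡ m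
  dist-realised-below {x} {y} t e m≤t with ℕ.m≤n⇒m<n∨m≡n m≤t
  ... | inj₂ refl = x , y , e
  ... | inj₁ (s≤s m≤t′) with dist-step e
  ... | w , _ , e′ = dist-realised-below _ e′ m≤t′

  dist-realised : ∀ {m} → m ≤ D → ∃ λ a → ∃ λ b → dist a b ≡ m
  dist-realised m≤D with proj₂ (proj₁ dr)
  ... | x , y , e = dist-realised-below D (distIs⇒dist D e) m≤D

  intersection-comm : ∀ {h} i j → h ≤ D → p h i j ≡ p h j i
  intersection-comm i j h≤D with dist-realised h≤D
  ... | x , y , e = trans (sym (intersection-count i j e))
      (trans (countF-cong (λ z → ∧-comm (dist x z ≡ᵇ i) _)) (intersection-count j i (trans (dist-sym y x) e)))

  bᵢ≥1 : ∀ {i} → suc i ≤ D → 1 ≤ bᵢ p i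
  bᵢ≥1 i<D with dist-realised i<D
  ... | x , y , e with dist-step e
  ... | w , a , e′ = intersection-≥1 x e′ (adj⇒dist≡1 (trans (symm w x) a)) (trans (dist-sym y x) e)

  adj-dist-cases : ∀ x {y z i} → adj y z ≡ true → dist x y ≡ suc i →
    dist x z ≡ i ⊎ dist x z ≡ suc i ⊎ dist x z ≡ suc (suc i)
  adj-dist-cases x a e with dist-adj x a
  ... | inj₁ e′        = inj₂ (inj₁ (trans e′ e))
  ... | inj₂ (inj₁ e′) = inj₂ (inj₂ (trans e′ (cong suc e)))
  ... | inj₂ (inj₂ e′) = inj₁ (ℕ.suc-injective (trans e′ e))

  cᵢ+aᵢ+bᵢ≡k : ∀ {i} → 1 ≤ i → i ≤ D → cᵢ p i ℕ.+ aᵢ p i ℕ.+ bᵢ p i ≡ valency p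
  cᵢ+aᵢ+bᵢ≡k {suc i} _ i≤D with dist-realised i≤D
  ... | x , y , e = trans (sym (trans (countF-+₃ _ _ _ _ split) (cong₂ ℕ._+_ (cong₂ ℕ._+_ (count i) (count (suc i)))
                                                                          (count (suc (suc i))))))
                          (degree x)
    where
    count : ∀ j → countF (λ z → adj x z ∧ (dist y z ≡ᵇ j)) ≡ p (suc i) 1 j
    count j = trans (count-neighbours x _) (intersection-count 1 j e)
    split : ∀ z → indicator (adj x z) ≡ indicator (adj x z ∧ (dist y z ≡ᵇ i))
                    ℕ.+ indicator (adj x z ∧ (dist y z ≡ᵇ suc i)) ℕ.+ indicator (adj x z ∧ (dist y z ≡ᵇ suc (suc i)))
    split z with adj x z in a
    ... | false = refl
    ... | true  = sym (indicator-one-of-three i (adj-dist-cases y a (trans (dist-sym y x) e)))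

  a₀≡0 : aᵢ p 0 ≡ 0
  a₀≡0 = trans (sym (intersection-count 1 0 (dist-refl x))) (countF-≡0 _ none)
    where
    x : Fin n
    x = proj₁ (proj₂ (proj₁ dr))
    none : ∀ z → (dist x z ≡ᵇ 1) ∧ (dist x z ≡ᵇ 0) ≡ false
    none z with dist x z
    ... | zero        = refl
    ... | suc zero    = refl
    ... | suc (suc _) = refl

  -- Either t lies in layer 2 and is counted from w, or t lies in layer 3 and is counted from y.
  triangle⇒a₂≥1 : ∀ {x y w v t} → dist x y ≡ 1 → adj y w ≡ true → dist x w ≡ 2 → adj w v ≡ true →
    dist x v ≡ 3 → adj w t ≡ true → adj v t ≡ true → 1 ≤ aᵢ p 2
  triangle⇒a₂≥1 {x} {y} {w} {v} {t} dxy ayw dxw awv dxv awt avt with adj-dist-cases x awt dxw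
  ... | inj₁ dxt        = ⊥-elim (ℕ.<-irrefl refl (subst₂ _≤_ dxv (cong suc dxt) (dist-adj-≤ x (trans (symm t v) avt))))
  ... | inj₂ (inj₁ dxt) = intersection-≥1 t (trans (dist-sym w x) dxw) (adj⇒dist≡1 awt) dxt
  ... | inj₂ (inj₂ dxt) = intersection-≥1 t (trans (dist-sym v y) (dist-y≡2 awv dxv)) (adj⇒dist≡1 avt) (dist-y≡2 awt dxt)
    where
    dist-y≡2 : ∀ {u} → adj w u ≡ true → dist x u ≡ 3 → dist y u ≡ 2
    dist-y≡2 {u} awu dxu = ℕ.≤-antisym
      (subst (λ d → dist y u ≤ suc d) (adj⇒dist≡1 ayw) (dist-adj-≤ y awu))
      (ℕ.≤-pred (subst₂ _≤_ dxu (cong (ℕ._+ dist y u) dxy) (dist-triangle x y u)))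

  a₂≡0⇒a₁≡0 : 3 ≤ D → aᵢ p 2 ≡ 0 → aᵢ p 1 ≡ 0
  a₂≡0⇒a₁≡0 3≤D a₂≡0 with aᵢ p 1 in a₁≡ | dist-realised 3≤D
  ... | zero  | _ = refl
  ... | suc _ | v , x , dvx with dist-step dvx
  ... | w , avw , dwx with dist-step dwx
  ... | y , awy , dyx
    with countF-witness (λ z → (dist w z ≡ᵇ 1) ∧ (dist v z ≡ᵇ 1))
                        (subst (1 ≤_) (sym (trans (intersection-count 1 1 dwv) a₁≡)) (s≤s z≤n))
    where
    dwv : dist w v ≡ 1
    dwv = adj⇒dist≡1 (trans (symm w v) avw)
  ... | t , t∈ = ⊥-elim (ℕ.<-irrefl refl (subst (1 ≤_) a₂≡0
      (triangle⇒a₂≥1 (trans (dist-sym x y) dyx) (trans (symm y w) awy) (trans (dist-sym x w) dwx)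
                     (trans (symm w v) avw) (trans (dist-sym x v) dvx)
                     (dist≡1⇒adj (≡ᵇ-true⇒≡ (proj₁ (∧-true t∈))))
                     (dist≡1⇒adj (≡ᵇ-true⇒≡ (proj₂ (∧-true t∈)))))))

  colour-along : ∀ (col : Fin n → Bool) → (∀ x y → adj x y ≡ true → ¬ (col x ≡ col y)) →
    ∀ m {y z} → dist y z ≡ m → col z ≡ notⁿ m (col y)
  colour-along col proper zero    e with dist≡0⇒≡ e
  ... | refl = refl
  colour-along col proper (suc m) {y} e with dist-step e
  ... | w , a , e′ = trans (colour-along col proper m e′) (cong (notⁿ m) (flip (proper y w a)))
    where
    flip : ∀ {b c} → ¬ (b ≡ c) → c ≡ not b
    flip {true}  {true}  b≢c = ⊥-elim (b≢c refl)
    flip {true}  {false} _   = refl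
    flip {false} {true}  _   = refl
    flip {false} {false} b≢c = ⊥-elim (b≢c refl)

  bipartite⇒aᵢ≡0 : Bipartite Γ → ∀ {i} → i ≤ D → aᵢ p i ≡ 0
  bipartite⇒aᵢ≡0 (col , proper) {i} i≤D with dist-realised i≤D
  ... | x , y , e = trans (sym (intersection-count 1 i e)) (countF-≡0 _ none)
    where
    none : ∀ z → (dist x z ≡ᵇ 1) ∧ (dist y z ≡ᵇ i) ≡ false
    none z with dist x z ≡ᵇ 1 in e₁ | dist y z ≡ᵇ i in e₂
    ... | false | _     = refl
    ... | true  | false = refl
    ... | true  | true  = ⊥-elim (proper x z (dist≡1⇒adj (≡ᵇ-true⇒≡ e₁))
        (trans (colour-along col proper i (trans (dist-sym y x) e))
               (sym (colour-along col proper i (≡ᵇ-true⇒≡ e₂)))))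

  aᵢ≡0⇒bipartite : (∀ {i} → i ≤ D → aᵢ p i ≡ 0) → Bipartite Γ
  aᵢ≡0⇒bipartite aᵢ≡0 = (λ z → notⁿ (dist x z) true) , proper
    where
    x : Fin n
    x = proj₁ (proj₂ (proj₁ dr))
    proper : ∀ y z → adj y z ≡ true → ¬ (notⁿ (dist x y) true ≡ notⁿ (dist x z) true)
    proper y z a same with dist-adj x a
    ... | inj₁ e = ℕ.<-irrefl refl (subst (1 ≤_) (aᵢ≡0 (dist-≤D x y))
                     (intersection-≥1 z (dist-sym y x) (adj⇒dist≡1 a) e))
    ... | inj₂ (inj₁ e) = not-≢ _ (sym (trans same (trans (cong (λ d → notⁿ d true) e) (notⁿ-not (dist x y) true))))
    ... | inj₂ (inj₂ e) = not-≢ _ (trans (sym (notⁿ-not (dist x z) true)) (trans (cong (λ d → notⁿ d true) e) same))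

  count-layer-neighbours : ∀ x y → countF (λ z → adj y z ∧ (dist x z ≡ᵇ dist x y)) ≡ aᵢ p (dist x y)
  count-layer-neighbours x y = trans (count-neighbours y _) (intersection-count 1 (dist x y) (dist-sym y x))

  count-neighbours-in-layer : ∀ x i y → countF (λ z → (dist x z ≡ᵇ i) ∧ adj z y) ≡ p (dist x y) i 1
  count-neighbours-in-layer x i y =
    trans (countF-cong (λ z → cong ((dist x z ≡ᵇ i) ∧_) (trans (symm z y) (adj≡dist≡ᵇ1 y z))))
          (intersection-count i 1 refl)

  intersection-far : ∀ {h} i → h ≤ D → ¬ (h ≡ i) → ¬ (h ≡ suc i) → ¬ (h ≡ suc (suc i)) → p h (suc i) 1 ≡ 0
  intersection-far {h} i h≤D h≢i h≢i+1 h≢i+2 with p h (suc i) 1 in e | dist-realised h≤D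
  ... | zero  | _ = refl
  ... | suc _ | x , y , dxy
    with countF-witness _ (subst (1 ≤_) (sym (trans (intersection-count (suc i) 1 dxy) e)) (s≤s z≤n))
  ... | z , z∈ with adj-dist-cases x (dist≡1⇒adj (trans (dist-sym z y) (≡ᵇ-true⇒≡ (proj₂ (∧-true z∈)))))
                                    (≡ᵇ-true⇒≡ (proj₁ (∧-true z∈)))
  ... | inj₁ e′        = ⊥-elim (h≢i (trans (sym dxy) e′))
  ... | inj₂ (inj₁ e′) = ⊥-elim (h≢i+1 (trans (sym dxy) e′))
  ... | inj₂ (inj₂ e′) = ⊥-elim (h≢i+2 (trans (sym dxy) e′))

module Sums {ℓ₁ ℓ₂ : Level} (R : CommutativeRing ℓ₁ ℓ₂) where
  open CommutativeRing R hiding (zero)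
  open import Relation.Binary.Reasoning.Setoid setoid

  Σ : ∀ {m} → (Fin m → Carrier) → Carrier
  Σ = sumF R

  Σ-cong : ∀ {m} {f g : Fin m → Carrier} → (∀ i → f i ≈ g i) → Σ f ≈ Σ g
  Σ-cong {zero}  e = refl
  Σ-cong {suc m} e = +-cong (e zero) (Σ-cong (λ i → e (suc i)))

  Σ-≈0 : ∀ {m} {f : Fin m → Carrier} → (∀ i → f i ≈ 0#) → Σ f ≈ 0#
  Σ-≈0 {zero}  e = refl
  Σ-≈0 {suc m} e = trans (+-cong (e zero) (Σ-≈0 (λ i → e (suc i)))) (+-identityˡ 0#)

  Σ-+ : ∀ {m} (f g : Fin m → Carrier) → Σ (λ i → f i + g i) ≈ Σ f + Σ g
  Σ-+ {zero}  f g = sym (+-identityˡ 0#)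
  Σ-+ {suc m} f g = trans (+-congˡ (Σ-+ (λ i → f (suc i)) (λ i → g (suc i))))
                          (+-interchange _ _ _ _)
    where open import Algebra.Properties.CommutativeSemigroup +-commutativeSemigroup
            renaming (interchange to +-interchange)

  *-Σ : ∀ {m} x (f : Fin m → Carrier) → x * Σ f ≈ Σ (λ i → x * f i)
  *-Σ {zero}  x f = zeroʳ x
  *-Σ {suc m} x f = trans (distribˡ x _ _) (+-congˡ (*-Σ x (λ i → f (suc i))))

  Σ-* : ∀ {m} (f : Fin m → Carrier) x → Σ f * x ≈ Σ (λ i → f i * x)
  Σ-* f x = trans (*-comm _ x) (trans (*-Σ x f) (Σ-cong (λ i → *-comm x (f i))))

  Σ-swap : ∀ {m l} (f : Fin m → Fin l → Carrier) → Σ (λ i → Σ (λ j → f i j)) ≈ Σ (λ j → Σ (λ i → f i j))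
  Σ-swap {zero} {l} f = sym (Σ-≈0 {l} (λ _ → refl))
  Σ-swap {suc m} {l} f = begin
    Σ (f zero) + Σ (λ i → Σ (f (suc i)))           ≈⟨ +-congˡ (Σ-swap (f ∘ suc)) ⟩
    Σ (f zero) + Σ (λ j → Σ (λ i → f (suc i) j))   ≈⟨ sym (Σ-+ (f zero) _) ⟩
    Σ (λ j → f zero j + Σ (λ i → f (suc i) j))     ∎

  select : Bool → Carrier → Carrier
  select b x = if b then x else 0#

  select-cong : ∀ b {x y} → x ≈ y → select b x ≈ select b y
  select-cong true  e = e
  select-cong false e = refl

  *-select : ∀ b x y → x * select b y ≈ select b (x * y)
  *-select true  x y = refl
  *-select false x y = zeroʳ x

  select-* : ∀ b x y → select b x * y ≈ select b (x * y)
  select-* true  x y = refl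
  select-* false x y = zeroˡ y

  select-Σ : ∀ {m} b (g : Fin m → Bool) (f : Fin m → Carrier) →
    select b (Σ (λ i → select (g i) (f i))) ≈ Σ (λ i → select (b ∧ g i) (f i))
  select-Σ true  g f = refl
  select-Σ {m} false g f = sym (Σ-≈0 {m} (λ _ → refl))

  Σ-select-const : ∀ {m} (g : Fin m → Bool) x → Σ (λ i → select (g i) x) ≈ fromℕ R (countF g) * x
  Σ-select-const {zero}  g x = sym (zeroˡ x)
  Σ-select-const {suc m} g x with g zero
  ... | true  = trans (+-congˡ (Σ-select-const (g ∘ suc) x))
                      (trans (+-congʳ (sym (*-identityˡ x))) (sym (distribʳ x 1# _)))
  ... | false = trans (+-congˡ (Σ-select-const (g ∘ suc) x)) (+-identityˡ _)

  Σ-select-unique : ∀ {m} (g : Fin m → Bool) (f : Fin m → Carrier) i → g i ≡ true →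
    (∀ j → g j ≡ true → j ≡ i) → Σ (λ j → select (g j) (f j)) ≈ f i
  Σ-select-unique g f zero gi unique rewrite gi =
    trans (+-congˡ (Σ-≈0 off-zero)) (+-identityʳ _)
    where
    off-zero : ∀ j → select (g (suc j)) (f (suc j)) ≈ 0#
    off-zero j with g (suc j) in gj
    ... | true  with unique (suc j) gj
    ... | ()
    off-zero j | false = refl
  Σ-select-unique g f (suc i) gi unique with g zero in g0
  ... | true  with unique zero g0
  ... | ()
  Σ-select-unique g f (suc i) gi unique | false =
    trans (+-identityˡ _) (Σ-select-unique (g ∘ suc) (f ∘ suc) i gi (λ j gj → suc-injective (unique (suc j) gj)))

module FieldOfCharacteristicZero {ℓ₁ ℓ₂ : Level} (F : CommutativeRing ℓ₁ ℓ₂) (isField : IsFieldChar0 F) where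
  open CommutativeRing F hiding (zero)
  open import Algebra.Properties.Ring ring using (x∙y⁻¹≈ε⇒x≈y)
  open IntegerCoefficients F using (fromℕ-+)
  open import Relation.Binary.Reasoning.Setoid setoid

  1≉0 : ¬ (1# ≈ 0#)
  1≉0 = proj₁ isField

  fromℕ≈0⇒≡0 : ∀ m → fromℕ F m ≈ 0# → m ≡ 0
  fromℕ≈0⇒≡0 = proj₂ (proj₂ isField)

  fromℕ-≉0 : ∀ {m} → 1 ≤ m → ¬ (fromℕ F m ≈ 0#)
  fromℕ-≉0 {suc m} _ e with fromℕ≈0⇒≡0 (suc m) e
  ... | ()

  double≈0⇒≡0 : ∀ {m} → fromℕ F m + fromℕ F m ≈ 0# → m ≡ 0
  double≈0⇒≡0 {m} e = ℕ.m+n≡0⇒m≡0 m (fromℕ≈0⇒≡0 (m ℕ.+ m) (trans (fromℕ-+ m m) e))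

  -- fromℕ⁻¹ 0 is the junk value 0#
  fromℕ⁻¹ : ℕ → Carrier
  fromℕ⁻¹ zero    = 0#
  fromℕ⁻¹ (suc m) = proj₁ (proj₁ (proj₂ isField) (fromℕ F (suc m)) (fromℕ-≉0 {suc m} (s≤s z≤n)))

  fromℕ-*-fromℕ⁻¹ : ∀ {m} → 1 ≤ m → fromℕ F m * fromℕ⁻¹ m ≈ 1#
  fromℕ-*-fromℕ⁻¹ {suc m} _ = proj₂ (proj₁ (proj₂ isField) (fromℕ F (suc m)) (fromℕ-≉0 {suc m} (s≤s z≤n)))

  *-cancelˡ-≈0 : ∀ {a x} → ¬ (a ≈ 0#) → a * x ≈ 0# → x ≈ 0#
  *-cancelˡ-≈0 {a} {x} a≉0 e with proj₁ (proj₂ isField) a a≉0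
  ... | b , ab≈1 = begin
    x           ≈⟨ sym (*-identityˡ x) ⟩
    1# * x      ≈⟨ *-congʳ (sym (trans (*-comm b a) ab≈1)) ⟩
    (b * a) * x ≈⟨ *-assoc b a x ⟩
    b * (a * x) ≈⟨ *-congˡ e ⟩
    b * 0#      ≈⟨ zeroʳ b ⟩
    0#          ∎

  *-cancelʳ-≈0 : ∀ {a x} → ¬ (a ≈ 0#) → x * a ≈ 0# → x ≈ 0#
  *-cancelʳ-≈0 a≉0 e = *-cancelˡ-≈0 a≉0 (trans (*-comm _ _) e)

  *-cancelˡ : ∀ {a x y} → ¬ (a ≈ 0#) → a * x ≈ a * y → x ≈ y
  *-cancelˡ {a} {x} {y} a≉0 e = x∙y⁻¹≈ε⇒x≈y x y (*-cancelˡ-≈0 a≉0 (begin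
    a * (x - y)         ≈⟨ distribˡ a x (- y) ⟩
    a * x + a * - y     ≈⟨ +-cong e (sym (-‿distribʳ-* a y)) ⟩
    a * y + - (a * y)   ≈⟨ -‿inverseʳ (a * y) ⟩
    0#                  ∎))
    where open import Algebra.Properties.Ring ring using (-‿distribʳ-*)

module StandardSequence {ℓ₁ ℓ₂ : Level} (F : CommutativeRing ℓ₁ ℓ₂) (isField : IsFieldChar0 F)
                        {n : ℕ} (Γ : Graph n) (D : ℕ) (p : ℕ → ℕ → ℕ → ℕ) (dr : IsDistanceRegular Γ D p) where
  open CommutativeRing F hiding (zero)
  open import Algebra.Properties.Ring ring using (-1*x≈-x; -‿involutive; x∙y⁻¹≈ε⇒x≈y)
  open IntegerCoefficients F
  open FieldOfCharacteristicZero F isField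
  open DistanceRegular Γ D p dr
    using (bᵢ≥1; cᵢ+aᵢ+bᵢ≡k; bipartite⇒aᵢ≡0)
  open import Relation.Binary.Reasoning.Setoid setoid

  k : Carrier
  k = fromℕ F (valency p)

  k≉0 : 1 ≤ D → ¬ (k ≈ 0#)
  k≉0 1≤D = fromℕ-≉0 (bᵢ≥1 1≤D)

  c a b : ℕ → Carrier
  c i = fromℕ F (cᵢ p i)
  a i = fromℕ F (aᵢ p i)
  b i = fromℕ F (bᵢ p i)

  c+a+b≈k : ∀ {i} → 1 ≤ i → i ≤ D → c i + a i + b i ≈ k
  c+a+b≈k {i} 1≤i i≤D = begin
    c i + a i + b i                        ≈⟨ sym (+-congʳ (fromℕ-+ (cᵢ p i) (aᵢ p i))) ⟩
    fromℕ F (cᵢ p i ℕ.+ aᵢ p i) + b i      ≈⟨ sym (fromℕ-+ (cᵢ p i ℕ.+ aᵢ p i) (bᵢ p i)) ⟩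
    fromℕ F (cᵢ p i ℕ.+ aᵢ p i ℕ.+ bᵢ p i) ≈⟨ reflexive (≡.cong (fromℕ F) (cᵢ+aᵢ+bᵢ≡k 1≤i i≤D)) ⟩
    k                                      ∎

  standardSequence : Carrier → ℕ → Carrier
  standardSequence θ zero          = 1#
  standardSequence θ (suc zero)    = θ * fromℕ⁻¹ (valency p)
  standardSequence θ (suc (suc i)) =
    (θ * u (suc i) - c (suc i) * u i - a (suc i) * u (suc i)) * fromℕ⁻¹ (bᵢ p (suc i))
    where
    u : ℕ → Carrier
    u = standardSequence θ

  standardSequence-isStandard : 1 ≤ D → ∀ θ → IsStandardSequence F D p θ (standardSequence θ)
  standardSequence-isStandard 1≤D θ = refl , first , recurrence
    where
    u : ℕ → Carrier
    u = standardSequence θ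
    swap-left : ∀ x y z → x * (y * z) ≈ y * (x * z)
    swap-left = solve 3 (λ x y z → x :* (y :* z) := y :* (x :* z)) refl
    first : k * (θ * fromℕ⁻¹ (valency p)) ≈ θ
    first = begin
      k * (θ * fromℕ⁻¹ (valency p)) ≈⟨ swap-left k θ _ ⟩
      θ * (k * fromℕ⁻¹ (valency p)) ≈⟨ *-congˡ (fromℕ-*-fromℕ⁻¹ (bᵢ≥1 1≤D)) ⟩
      θ * 1#                        ≈⟨ *-identityʳ θ ⟩
      θ                             ∎
    recurrence : ∀ i → 1 ≤ i → suc i ≤ D →
      c i * u (i ∸ 1) + a i * u i + b i * u (suc i) ≈ θ * u i
    recurrence (suc i) _ i<D = begin
      c (suc i) * u i + a (suc i) * u (suc i) + b (suc i) * (r * fromℕ⁻¹ (bᵢ p (suc i)))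
        ≈⟨ +-congˡ (swap-left (b (suc i)) r _) ⟩
      c (suc i) * u i + a (suc i) * u (suc i) + r * (b (suc i) * fromℕ⁻¹ (bᵢ p (suc i)))
        ≈⟨ +-congˡ (trans (*-congˡ (fromℕ-*-fromℕ⁻¹ (bᵢ≥1 i<D))) (*-identityʳ r)) ⟩
      c (suc i) * u i + a (suc i) * u (suc i) + r
        ≈⟨ solve 5 (λ c u a u′ θ → c :* u :+ a :* u′ :+ (θ :* u′ :- c :* u :- a :* u′) := θ :* u′) refl
                   (c (suc i)) (u i) (a (suc i)) (u (suc i)) θ ⟩
      θ * u (suc i) ∎
      where
      r : Carrier
      r = θ * u (suc i) - c (suc i) * u i - a (suc i) * u (suc i)

  [-1]^_ : ℕ → Carrier
  [-1]^ zero  = 1#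
  [-1]^ suc i = - ([-1]^ i)

  [-1]^-≉0 : ∀ i → ¬ ([-1]^ i ≈ 0#)
  [-1]^-≉0 zero    = 1≉0
  [-1]^-≉0 (suc i) e = [-1]^-≉0 i (trans (sym (-‿involutive _)) (trans (-‿cong e) -0#≈0#))
    where open import Algebra.Properties.Ring ring using (-0#≈0#)

  -k≈k*-1 : - k ≈ k * - 1#
  -k≈k*-1 = sym (trans (*-comm k (- 1#)) (-1*x≈-x k))

  alternation-defect : ∀ {θ u i s} → IsStandardSequence F D p θ u → θ ≈ - k → 1 ≤ i → suc i ≤ D →
    u (i ∸ 1) ≈ s → u i ≈ - s → b i * (u (suc i) - s) ≈ (a i + a i) * s
  alternation-defect {θ} {u} {i} {s} (_ , _ , recurrence) θ≈-k 1≤i i<D uᵢ₋₁≈s uᵢ≈-s = begin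
    b i * (u (suc i) - s)
      ≈⟨ solve 5 (λ c a b u′ s → b :* (u′ :- s)
                                 := (c :* s :+ a :* (:- s) :+ b :* u′) :- (:- (c :+ a :+ b)) :* (:- s) :+ (a :+ a) :* s)
               refl (c i) (a i) (b i) (u (suc i)) s ⟩
    (c i * s + a i * - s + b i * u (suc i)) - (- (c i + a i + b i)) * - s + (a i + a i) * s
      ≈⟨ +-congʳ (+-cong (+-congʳ (+-cong (*-congˡ (sym uᵢ₋₁≈s)) (*-congˡ (sym uᵢ≈-s))))
                         (-‿cong (*-cong (trans (-‿cong (c+a+b≈k 1≤i (ℕ.<⇒≤ i<D))) (sym θ≈-k)) (sym uᵢ≈-s)))) ⟩
    (c i * u (i ∸ 1) + a i * u i + b i * u (suc i)) - θ * u i + (a i + a i) * s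
      ≈⟨ +-congʳ (+-congʳ (recurrence i 1≤i i<D)) ⟩
    θ * u i - θ * u i + (a i + a i) * s
      ≈⟨ trans (+-congʳ (-‿inverseʳ _)) (+-identityˡ _) ⟩
    (a i + a i) * s ∎

  alternating-if-aᵢ≡0 : ∀ {θ u} → IsStandardSequence F D p θ u → 1 ≤ D → θ ≈ - k →
    (∀ {i} → i ≤ D → aᵢ p i ≡ 0) → ∀ i → suc i ≤ D → u i ≈ [-1]^ i × u (suc i) ≈ [-1]^ suc i
  alternating-if-aᵢ≡0 std@(u₀≈1 , ku₁≈θ , _) 1≤D θ≈-k aᵢ≡0 zero _ =
    u₀≈1 , *-cancelˡ (k≉0 1≤D) (trans ku₁≈θ (trans θ≈-k -k≈k*-1))
  alternating-if-aᵢ≡0 {u = u} std 1≤D θ≈-k aᵢ≡0 (suc i) i<D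
    with alternating-if-aᵢ≡0 std 1≤D θ≈-k aᵢ≡0 i (ℕ.<⇒≤ i<D)
  ... | uᵢ≈s , uᵢ₊₁≈-s = uᵢ₊₁≈-s , trans uᵢ₊₂≈s (sym (-‿involutive s))
    where
    s : Carrier
    s = [-1]^ i
    aᵢ≈0 : a (suc i) ≈ 0#
    aᵢ≈0 = reflexive (≡.cong (fromℕ F) (aᵢ≡0 (ℕ.<⇒≤ i<D)))
    uᵢ₊₂≈s : u (suc (suc i)) ≈ s
    uᵢ₊₂≈s = x∙y⁻¹≈ε⇒x≈y _ _ (*-cancelˡ-≈0 (fromℕ-≉0 (bᵢ≥1 i<D)) (begin
      b (suc i) * (u (suc (suc i)) - s)        ≈⟨ alternation-defect std θ≈-k (s≤s z≤n) i<D uᵢ≈s uᵢ₊₁≈-s ⟩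
      (a (suc i) + a (suc i)) * s              ≈⟨ *-congʳ (trans (+-cong aᵢ≈0 aᵢ≈0) (+-identityˡ 0#)) ⟩
      0# * s                                   ≈⟨ zeroˡ s ⟩
      0#                                       ∎))

  bipartite⇒classicalMinusOneType : 1 ≤ D → ∀ {θ} → θ ≈ - k → Bipartite Γ → ClassicalMinusOneType F D p θ
  bipartite⇒classicalMinusOneType 1≤D θ≈-k bipartite u std = 0# , step
    where
    step : ∀ i → 1 ≤ i → i ≤ D → u i ≈ - 1# * u (i ∸ 1) + 0#
    step (suc i) _ i<D with alternating-if-aᵢ≡0 std 1≤D θ≈-k (bipartite⇒aᵢ≡0 bipartite) i i<D
    ... | uᵢ≈s , uᵢ₊₁≈-s = begin
      u (suc i)          ≈⟨ uᵢ₊₁≈-s ⟩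
      - ([-1]^ i)        ≈⟨ -‿cong (sym uᵢ≈s) ⟩
      - u i              ≈⟨ sym (-1*x≈-x (u i)) ⟩
      - 1# * u i         ≈⟨ sym (+-identityʳ _) ⟩
      - 1# * u i + 0#    ∎

  module OfClassicalMinusOneType (3≤D : 3 ≤ D) {θ u} (std : IsStandardSequence F D p θ u) (θ≉k : ¬ (θ ≈ k))
                                 {γ} (step : ∀ i → 1 ≤ i → i ≤ D → u i ≈ - 1# * u (i ∸ 1) + γ) where
    open DistanceRegular Γ D p dr using (a₀≡0; a₂≡0⇒a₁≡0)

    1≤D : 1 ≤ D
    1≤D = ℕ.≤-trans (s≤s z≤n) 3≤D

    2≤D : 2 ≤ D
    2≤D = ℕ.≤-trans (s≤s (s≤s z≤n)) 3≤D

    u₀≈1 : u 0 ≈ 1#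
    u₀≈1 = proj₁ std

    recurrence : ∀ i → 1 ≤ i → suc i ≤ D → c i * u (i ∸ 1) + a i * u i + b i * u (suc i) ≈ θ * u i
    recurrence = proj₂ (proj₂ std)

    θ≈ku₁ : θ ≈ k * u 1
    θ≈ku₁ = sym (proj₁ (proj₂ std))

    step′ : ∀ i → 1 ≤ i → i ≤ D → u i ≈ - u (i ∸ 1) + γ
    step′ i 1≤i i≤D = trans (step i 1≤i i≤D) (+-congʳ (-1*x≈-x _))

    γ≈u₁+1 : γ ≈ u 1 + 1#
    γ≈u₁+1 = begin
      γ                   ≈⟨ solve 2 (λ γ x → γ := (:- x :+ γ) :+ x) refl γ 1# ⟩
      (- 1# + γ) + 1#     ≈⟨ +-congʳ (sym (trans (step′ 1 (s≤s z≤n) 1≤D) (+-congʳ (-‿cong u₀≈1)))) ⟩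
      u 1 + 1#            ∎

    u₂≈1 : u 2 ≈ 1#
    u₂≈1 = begin
      u 2                 ≈⟨ step′ 2 (s≤s z≤n) 2≤D ⟩
      - u 1 + γ           ≈⟨ +-congˡ γ≈u₁+1 ⟩
      - u 1 + (u 1 + 1#)  ≈⟨ solve 2 (λ x y → :- x :+ (x :+ y) := y) refl (u 1) 1# ⟩
      1#                  ∎

    u₃≈u₁ : u 3 ≈ u 1
    u₃≈u₁ = begin
      u 3                 ≈⟨ step′ 3 (s≤s z≤n) 3≤D ⟩
      - u 2 + γ           ≈⟨ +-cong (-‿cong u₂≈1) γ≈u₁+1 ⟩
      - 1# + (u 1 + 1#)   ≈⟨ solve 2 (λ x y → :- y :+ (x :+ y) := x) refl (u 1) 1# ⟩
      u 1                 ∎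

    1-u₁≉0 : ¬ (1# - u 1 ≈ 0#)
    1-u₁≉0 e = θ≉k (begin
      θ                   ≈⟨ θ≈ku₁ ⟩
      k * u 1             ≈⟨ *-congˡ (sym (x∙y⁻¹≈ε⇒x≈y 1# (u 1) e)) ⟩
      k * 1#              ≈⟨ *-identityʳ k ⟩
      k                   ∎)

    a₂≡0 : aᵢ p 2 ≡ 0
    a₂≡0 = fromℕ≈0⇒≡0 _ (*-cancelʳ-≈0 1-u₁≉0 (begin
      a 2 * (1# - u 1)
        ≈⟨ solve 5 (λ c a b x o → a :* (o :- x) := (c :* x :+ a :* o :+ b :* x) :- (c :+ a :+ b) :* x)
                 refl (c 2) (a 2) (b 2) (u 1) 1# ⟩
      (c 2 * u 1 + a 2 * 1# + b 2 * u 1) - (c 2 + a 2 + b 2) * u 1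
        ≈⟨ +-cong (+-cong (+-congˡ (*-congˡ (sym u₂≈1))) (*-congˡ (sym u₃≈u₁)))
                  (-‿cong (trans (*-congʳ (c+a+b≈k (s≤s z≤n) 2≤D)) (sym θ≈ku₁))) ⟩
      (c 2 * u 1 + a 2 * u 2 + b 2 * u 3) - θ
        ≈⟨ +-congʳ (trans (recurrence 2 (s≤s z≤n) 3≤D) (trans (*-congˡ u₂≈1) (*-identityʳ θ))) ⟩
      θ - θ
        ≈⟨ -‿inverseʳ θ ⟩
      0# ∎))

    a₁≈0 : a 1 ≈ 0#
    a₁≈0 = reflexive (≡.cong (fromℕ F) (a₂≡0⇒a₁≡0 3≤D a₂≡0))

    u₁≈-1 : u 1 ≈ - 1#
    u₁≈-1 = x∙y⁻¹≈ε⇒x≈y _ _ (trans (+-congˡ (-‿involutive 1#))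
      (*-cancelʳ-≈0 1-u₁≉0 (*-cancelˡ-≈0 (k≉0 1≤D) (begin
        k * ((u 1 + 1#) * (1# - u 1))
          ≈⟨ solve 3 (λ k x o → k :* ((x :+ o) :* (o :- x)) := k :* o :* o :- (k :* x) :* x) refl k (u 1) 1# ⟩
        k * 1# * 1# - (k * u 1) * u 1
          ≈⟨ +-cong (trans (*-identityʳ _) (trans (*-identityʳ k) (sym (c+a+b≈k (s≤s z≤n) 1≤D))))
                    (-‿cong (*-congʳ (sym θ≈ku₁))) ⟩
        (c 1 + a 1 + b 1) - θ * u 1
          ≈⟨ +-congˡ (-‿cong (sym (recurrence 1 (s≤s z≤n) 2≤D))) ⟩
        (c 1 + a 1 + b 1) - (c 1 * u 0 + a 1 * u 1 + b 1 * u 2)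
          ≈⟨ +-congˡ (-‿cong (+-cong (+-cong (trans (*-congˡ u₀≈1) (*-identityʳ _))
                                             (trans (*-congʳ a₁≈0) (zeroˡ _)))
                                     (trans (*-congˡ u₂≈1) (*-identityʳ _)))) ⟩
        (c 1 + a 1 + b 1) - (c 1 + 0# + b 1)
          ≈⟨ +-congˡ (-‿cong (+-congʳ (+-congˡ (sym a₁≈0)))) ⟩
        (c 1 + a 1 + b 1) - (c 1 + a 1 + b 1)
          ≈⟨ -‿inverseʳ _ ⟩
        0# ∎))))

    θ≈-k : θ ≈ - k
    θ≈-k = trans θ≈ku₁ (trans (*-congˡ u₁≈-1) (sym -k≈k*-1))

    alternating : ∀ i → i ≤ D → u i ≈ [-1]^ i
    alternating zero    _   = u₀≈1
    alternating (suc i) i<D = begin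
      u (suc i)           ≈⟨ step′ (suc i) (s≤s z≤n) i<D ⟩
      - u i + γ           ≈⟨ +-cong (-‿cong (alternating i (ℕ.<⇒≤ i<D))) γ≈0 ⟩
      - ([-1]^ i) + 0#    ≈⟨ +-identityʳ _ ⟩
      [-1]^ suc i         ∎
      where
      γ≈0 : γ ≈ 0#
      γ≈0 = trans γ≈u₁+1 (trans (+-congʳ u₁≈-1) (-‿inverseˡ 1#))

    aᵢ≡0 : ∀ {i} → suc i ≤ D → aᵢ p i ≡ 0
    aᵢ≡0 {zero}  _   = a₀≡0
    aᵢ≡0 {suc i} i<D = double≈0⇒≡0 (*-cancelʳ-≈0 ([-1]^-≉0 i) (begin
      (a (suc i) + a (suc i)) * s    ≈⟨ sym (alternation-defect std θ≈-k (s≤s z≤n) i<D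
                                             (alternating i i≤D) (alternating (suc i) (ℕ.<⇒≤ i<D))) ⟩
      b (suc i) * (u (suc (suc i)) - s)
        ≈⟨ *-congˡ (x≈y⇒x∙y⁻¹≈ε (trans (alternating (suc (suc i)) i<D) (-‿involutive s))) ⟩
      b (suc i) * 0#                 ≈⟨ zeroʳ _ ⟩
      0#                             ∎))
      where
      s : Carrier
      s = [-1]^ i
      i≤D : i ≤ D
      i≤D = ℕ.≤-trans (ℕ.n≤1+n i) (ℕ.<⇒≤ i<D)
      open import Algebra.Properties.Ring ring using (x≈y⇒x∙y⁻¹≈ε)

module Eigenvectors {ℓ₁ ℓ₂ : Level} (F : CommutativeRing ℓ₁ ℓ₂) (isField : IsFieldChar0 F)
                    {n : ℕ} (Γ : Graph n) (D : ℕ) (p : ℕ → ℕ → ℕ → ℕ) (dr : IsDistanceRegular Γ D p) where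
  open CommutativeRing F hiding (zero)
  open Graph Γ
  open Counting
  open IntegerCoefficients F
  open Sums F
  open FieldOfCharacteristicZero F isField
  open DistanceRegular Γ D p dr
  open StandardSequence F isField Γ D p dr using (k; a; [-1]^_; [-1]^-≉0)
  open import Algebra.Properties.Ring ring using (-‿involutive)
  open import Relation.Binary.Reasoning.Setoid setoid

  i≢1+i : ∀ {i : ℕ} → ¬ (i ≡ suc i)
  i≢1+i ()

  i≢2+i : ∀ {i : ℕ} → ¬ (i ≡ suc (suc i))
  i≢2+i ()

  select-three : ∀ (f : ℕ → Carrier) i d → (¬ d ≡ i → ¬ d ≡ suc i → ¬ d ≡ suc (suc i) → f d ≈ 0#) →
    f d ≈ select (d ≡ᵇ i) (f i) + select (d ≡ᵇ suc i) (f (suc i)) + select (d ≡ᵇ suc (suc i)) (f (suc (suc i)))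
  select-three f i d off with d ≡ᵇ i in e₀ | d ≡ᵇ suc i in e₁ | d ≡ᵇ suc (suc i) in e₂
  ... | true  | true  | _     = ⊥-elim (i≢1+i (≡.trans (≡.sym (≡ᵇ-true⇒≡ {d} e₀)) (≡ᵇ-true⇒≡ {d} e₁)))
  ... | true  | false | true  = ⊥-elim (i≢2+i (≡.trans (≡.sym (≡ᵇ-true⇒≡ {d} e₀)) (≡ᵇ-true⇒≡ {d} e₂)))
  ... | false | true  | true  = ⊥-elim (i≢1+i (≡.trans (≡.sym (≡ᵇ-true⇒≡ {d} e₁)) (≡ᵇ-true⇒≡ {d} e₂)))
  ... | true  | false | false =
    trans (reflexive (≡.cong f (≡ᵇ-true⇒≡ {d} e₀))) (sym (trans (+-identityʳ _) (+-identityʳ _)))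
  ... | false | true  | false =
    trans (reflexive (≡.cong f (≡ᵇ-true⇒≡ {d} e₁))) (sym (trans (+-identityʳ _) (+-identityˡ _)))
  ... | false | false | true  =
    trans (reflexive (≡.cong f (≡ᵇ-true⇒≡ {d} e₂))) (sym (trans (+-congʳ (+-identityˡ 0#)) (+-identityˡ _)))
  ... | false | false | false =
    trans (off (≡ᵇ-false⇒≢ {d} e₀) (≡ᵇ-false⇒≢ {d} e₁) (≡ᵇ-false⇒≢ {d} e₂))
          (sym (trans (+-identityʳ _) (+-identityʳ _)))

  module LayerSums {θ : Carrier} (v : Fin n → Carrier)
                   (eigen : ∀ y → Σ (λ z → select (adj y z) (v z)) ≈ θ * v y) (x : Fin n) where

    V : ℕ → Carrier
    V i = Σ (λ z → select (dist x z ≡ᵇ i) (v z))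

    Σ-select-layer : ∀ r j → Σ (λ y → select (dist x y ≡ᵇ j) r * v y) ≈ r * V j
    Σ-select-layer r j = trans (Σ-cong {n} (λ y → trans (select-* _ r (v y)) (sym (*-select _ r (v y)))))
                               (sym (*-Σ {n} r _))

    Σ-one-layer : ∀ (f : ℕ → Carrier) h → (∀ y → ¬ dist x y ≡ h → f (dist x y) ≈ 0#) →
      Σ (λ y → f (dist x y) * v y) ≈ f h * V h
    Σ-one-layer f h off = trans (Σ-cong {n} (λ y → *-congʳ (only-h y))) (Σ-select-layer (f h) h)
      where
      only-h : ∀ y → f (dist x y) ≈ select (dist x y ≡ᵇ h) (f h)
      only-h y with dist x y ≡ᵇ h in e
      ... | true  = reflexive (≡.cong f (≡ᵇ-true⇒≡ e))
      ... | false = off y (≡ᵇ-false⇒≢ e)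

    Σ-three-layers : ∀ (f : ℕ → Carrier) i →
      (∀ y → ¬ dist x y ≡ i → ¬ dist x y ≡ suc i → ¬ dist x y ≡ suc (suc i) → f (dist x y) ≈ 0#) →
      Σ (λ y → f (dist x y) * v y) ≈ f i * V i + f (suc i) * V (suc i) + f (suc (suc i)) * V (suc (suc i))
    Σ-three-layers f i off = begin
      Σ (λ y → f (dist x y) * v y)
        ≈⟨ Σ-cong {n} (λ y → trans (*-congʳ (select-three f i (dist x y) (off y))) (distribʳ-three y)) ⟩
      Σ (λ y → s i y * v y + s (suc i) y * v y + s (suc (suc i)) y * v y)
        ≈⟨ trans (Σ-+ {n} _ _) (+-congʳ (Σ-+ {n} _ _)) ⟩
      Σ (λ y → s i y * v y) + Σ (λ y → s (suc i) y * v y) + Σ (λ y → s (suc (suc i)) y * v y)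
        ≈⟨ +-cong (+-cong (Σ-select-layer _ i) (Σ-select-layer _ (suc i))) (Σ-select-layer _ (suc (suc i))) ⟩
      f i * V i + f (suc i) * V (suc i) + f (suc (suc i)) * V (suc (suc i)) ∎
      where
      s : ℕ → Fin n → Carrier
      s j y = select (dist x y ≡ᵇ j) (f j)
      distribʳ-three : ∀ y → (s i y + s (suc i) y + s (suc (suc i)) y) * v y
                             ≈ s i y * v y + s (suc i) y * v y + s (suc (suc i)) y * v y
      distribʳ-three y = trans (distribʳ _ _ _) (+-congʳ (distribʳ _ _ _))

    layer-recurrence : ∀ i → let q = λ h → fromℕ F (p h (suc i) 1) in
      θ * V (suc i) ≈ q i * V i + q (suc i) * V (suc i) + q (suc (suc i)) * V (suc (suc i))
    layer-recurrence i = begin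
      θ * V (suc i)
        ≈⟨ *-Σ {n} θ _ ⟩
      Σ (λ z → θ * select (dist x z ≡ᵇ suc i) (v z))
        ≈⟨ Σ-cong {n} (λ z → trans (*-select _ θ (v z)) (select-cong _ (sym (eigen z)))) ⟩
      Σ (λ z → select (dist x z ≡ᵇ suc i) (Σ (λ y → select (adj z y) (v y))))
        ≈⟨ Σ-cong {n} (λ z → select-Σ {n} _ (adj z) v) ⟩
      Σ (λ z → Σ (λ y → select ((dist x z ≡ᵇ suc i) ∧ adj z y) (v y)))
        ≈⟨ Σ-swap {n} {n} _ ⟩
      Σ (λ y → Σ (λ z → select ((dist x z ≡ᵇ suc i) ∧ adj z y) (v y)))
        ≈⟨ Σ-cong {n} (λ y → trans (Σ-select-const {n} _ (v y))
                               (*-congʳ (reflexive (≡.cong (fromℕ F) (count-neighbours-in-layer x (suc i) y))))) ⟩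
      Σ (λ y → q (dist x y) * v y)
        ≈⟨ Σ-three-layers q i (λ y h≢i h≢i+1 h≢i+2 →
             reflexive (≡.cong (fromℕ F) (intersection-far i (dist-≤D x y) h≢i h≢i+1 h≢i+2))) ⟩
      q i * V i + q (suc i) * V (suc i) + q (suc (suc i)) * V (suc (suc i)) ∎
      where
      q : ℕ → Carrier
      q h = fromℕ F (p h (suc i) 1)

    V₀≈v : V 0 ≈ v x
    V₀≈v = Σ-select-unique {n} _ v x (≡⇒≡ᵇ-true (dist-refl x)) (λ z e → ≡.sym (dist≡0⇒≡ (≡ᵇ-true⇒≡ e)))

    V-beyond-D : V (suc D) ≈ 0#
    V-beyond-D = Σ-≈0 {n} (λ z → reflexive (≡.cong (λ b → select b (v z))
                   (≢⇒≡ᵇ-false (λ e → ℕ.<-irrefl ≡.refl (≡.subst (_≤ D) e (dist-≤D x z))))))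

    layers-vanish-from-D : V D ≈ 0# → ∀ t m → m ℕ.+ t ≡ D → V m ≈ 0# × V (suc m) ≈ 0#
    layers-vanish-from-D V[D]≈0 zero m e rewrite ℕ.+-identityʳ m | e = V[D]≈0 , V-beyond-D
    layers-vanish-from-D V[D]≈0 (suc t) m e
      with layers-vanish-from-D V[D]≈0 t (suc m) (≡.trans (≡.sym (ℕ.+-suc m t)) e)
    ... | V₁≈0 , V₂≈0 = *-cancelˡ-≈0 (fromℕ-≉0 bₘ≥1) (begin
      q m * V m
        ≈⟨ sym (trans (+-cong (+-congˡ (trans (*-congˡ V₁≈0) (zeroʳ _))) (trans (*-congˡ V₂≈0) (zeroʳ _)))
                      (trans (+-identityʳ _) (+-identityʳ _))) ⟩
      q m * V m + q (suc m) * V (suc m) + q (suc (suc m)) * V (suc (suc m))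
        ≈⟨ sym (layer-recurrence m) ⟩
      θ * V (suc m)   ≈⟨ *-congˡ V₁≈0 ⟩
      θ * 0#          ≈⟨ zeroʳ θ ⟩
      0#              ∎) , V₁≈0
      where
      q : ℕ → Carrier
      q h = fromℕ F (p h (suc m) 1)
      m<D : suc m ≤ D
      m<D = ≡.subst (suc m ≤_) (≡.trans (≡.sym (ℕ.+-suc m t)) e) (ℕ.m≤m+n (suc m) t)
      bₘ≥1 : 1 ≤ p m (suc m) 1
      bₘ≥1 = ≡.subst (1 ≤_) (intersection-comm 1 (suc m) (ℕ.<⇒≤ m<D)) (bᵢ≥1 m<D)

    V[D]≈0⇒v≈0 : V D ≈ 0# → v x ≈ 0#
    V[D]≈0⇒v≈0 V[D]≈0 = trans (sym V₀≈v) (proj₁ (layers-vanish-from-D V[D]≈0 D 0 ≡.refl))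

    module _ (θ≈-k : θ ≈ - k) (aᵢ≡0 : ∀ {i} → suc i ≤ D → aᵢ p i ≡ 0) where

      sign : Fin n → Carrier
      sign z = [-1]^ (dist x z)

      T : Carrier
      T = Σ (λ z → sign z * v z)

      neighbourSigns : Fin n → Carrier
      neighbourSigns y = Σ (λ z → select (adj y z) (sign z))

      θT≈Σ-neighbourSigns : θ * T ≈ Σ (λ y → neighbourSigns y * v y)
      θT≈Σ-neighbourSigns = begin
        θ * T
          ≈⟨ *-Σ {n} θ _ ⟩
        Σ (λ z → θ * (sign z * v z))
          ≈⟨ Σ-cong {n} (λ z → trans (swap-left θ (sign z) (v z)) (*-congˡ (sym (eigen z)))) ⟩
        Σ (λ z → sign z * Σ (λ y → select (adj z y) (v y)))
          ≈⟨ Σ-cong {n} (λ z → trans (*-Σ {n} (sign z) _) (Σ-cong {n} (λ y → *-select (adj z y) (sign z) (v y)))) ⟩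
        Σ (λ z → Σ (λ y → select (adj z y) (sign z * v y)))
          ≈⟨ Σ-swap {n} {n} _ ⟩
        Σ (λ y → Σ (λ z → select (adj z y) (sign z * v y)))
          ≈⟨ Σ-cong {n} (λ y → Σ-cong {n} (λ z → trans (reflexive (≡.cong (λ b → select b (sign z * v y)) (symm z y)))
                                                           (sym (select-* (adj y z) (sign z) (v y))))) ⟩
        Σ (λ y → Σ (λ z → select (adj y z) (sign z) * v y))
          ≈⟨ Σ-cong {n} (λ y → sym (Σ-* {n} _ (v y))) ⟩
        Σ (λ y → neighbourSigns y * v y) ∎
        where
        swap-left : ∀ a b c → a * (b * c) ≈ b * (a * c)
        swap-left = solve 3 (λ a b c → a :* (b :* c) := b :* (a :* c)) refl

      neighbourSigns≈ : ∀ y → neighbourSigns y ≈ (a (dist x y) + a (dist x y)) * sign y - k * sign y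
      neighbourSigns≈ y = begin
        neighbourSigns y
          ≈⟨ Σ-cong {n} split ⟩
        Σ (λ z → select (adj y z ∧ same z) s + select (adj y z ∧ not (same z)) (- s))
          ≈⟨ Σ-+ {n} _ _ ⟩
        Σ (λ z → select (adj y z ∧ same z) s) + Σ (λ z → select (adj y z ∧ not (same z)) (- s))
          ≈⟨ +-cong (Σ-select-const {n} _ s) (Σ-select-const {n} _ (- s)) ⟩
        A * s + B * - s
          ≈⟨ solve 3 (λ A B s → A :* s :+ B :* (:- s) := (A :+ A) :* s :- (A :+ B) :* s) refl A B s ⟩
        (A + A) * s - (A + B) * s
          ≈⟨ +-cong (*-congʳ (+-cong A≈a A≈a)) (-‿cong (*-congʳ A+B≈k)) ⟩
        (a (dist x y) + a (dist x y)) * s - k * s ∎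
        where
        s : Carrier
        s = sign y
        same : Fin n → Bool
        same z = dist x z ≡ᵇ dist x y
        A B : Carrier
        A = fromℕ F (countF (λ z → adj y z ∧ same z))
        B = fromℕ F (countF (λ z → adj y z ∧ not (same z)))
        A≈a : A ≈ a (dist x y)
        A≈a = reflexive (≡.cong (fromℕ F) (count-layer-neighbours x y))
        indicator-split : ∀ z →
          indicator (adj y z) ≡ indicator (adj y z ∧ same z) ℕ.+ indicator (adj y z ∧ not (same z))
        indicator-split z with adj y z | same z
        ... | false | _     = ≡.refl
        ... | true  | true  = ≡.refl
        ... | true  | false = ≡.refl
        A+B≈k : A + B ≈ k
        A+B≈k = trans (sym (fromℕ-+ (countF (λ z → adj y z ∧ same z)) (countF (λ z → adj y z ∧ not (same z)))))
          (reflexive (≡.cong (fromℕ F) (≡.trans (≡.sym (countF-+ (adj y) _ _ indicator-split)) (degree y))))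
        split : ∀ z → select (adj y z) (sign z) ≈ select (adj y z ∧ same z) s + select (adj y z ∧ not (same z)) (- s)
        split z with adj y z in ayz | same z in e
        ... | false | _     = sym (+-identityˡ 0#)
        ... | true  | true  = trans (reflexive (≡.cong [-1]^_ (≡ᵇ-true⇒≡ {dist x z} e))) (sym (+-identityʳ s))
        ... | true  | false = trans (opposite (dist-adj x ayz)) (sym (+-identityˡ (- s)))
          where
          opposite : dist x z ≡ dist x y ⊎ dist x z ≡ suc (dist x y) ⊎ suc (dist x z) ≡ dist x y → sign z ≈ - s
          opposite (inj₁ e′)        = ⊥-elim (≡ᵇ-false⇒≢ {dist x z} e e′)
          opposite (inj₂ (inj₁ e′)) = reflexive (≡.cong [-1]^_ e′)
          opposite (inj₂ (inj₂ e′)) = trans (sym (-‿involutive _)) (-‿cong (reflexive (≡.cong [-1]^_ e′)))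

      -- Σ_y G (dist x y) * v y is (θ + k) T, and only layer D contributes to it as aᵢ = 0 below D.
      G : ℕ → Carrier
      G h = (a h + a h) * [-1]^ h

      ΣGv≈0 : Σ (λ y → G (dist x y) * v y) ≈ 0#
      ΣGv≈0 = begin
        Σ (λ y → G (dist x y) * v y)
          ≈⟨ Σ-cong {n} shift ⟩
        Σ (λ y → neighbourSigns y * v y + k * (sign y * v y))
          ≈⟨ Σ-+ {n} _ _ ⟩
        Σ (λ y → neighbourSigns y * v y) + Σ (λ y → k * (sign y * v y))
          ≈⟨ +-cong (sym θT≈Σ-neighbourSigns) (sym (*-Σ {n} k _)) ⟩
        θ * T + k * T
          ≈⟨ +-congʳ (*-congʳ θ≈-k) ⟩
        - k * T + k * T
          ≈⟨ solve 2 (λ k T → :- k :* T :+ k :* T := con (ℤ.+ 0)) refl k T ⟩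
        0# ∎
        where
        shift : ∀ y → G (dist x y) * v y ≈ neighbourSigns y * v y + k * (sign y * v y)
        shift y = begin
          G (dist x y) * v y
            ≈⟨ solve 4 (λ g k s w → g :* s :* w := (g :* s :- k :* s) :* w :+ k :* (s :* w)) refl
                       (a (dist x y) + a (dist x y)) k (sign y) (v y) ⟩
          ((a (dist x y) + a (dist x y)) * sign y - k * sign y) * v y + k * (sign y * v y)
            ≈⟨ +-congʳ (*-congʳ (sym (neighbourSigns≈ y))) ⟩
          neighbourSigns y * v y + k * (sign y * v y) ∎

      a[D]≡0 : ¬ (v x ≈ 0#) → aᵢ p D ≡ 0
      a[D]≡0 vx≉0 with aᵢ p D ℕ.≟ 0
      ... | yes a[D]≡0 = a[D]≡0
      ... | no  a[D]≢0 = ⊥-elim (vx≉0 (V[D]≈0⇒v≈0 (*-cancelˡ-≈0 G[D]≉0 (trans (sym (Σ-one-layer G D off)) ΣGv≈0))))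
        where
        G[D]≉0 : ¬ (G D ≈ 0#)
        G[D]≉0 G[D]≈0 = a[D]≢0 (double≈0⇒≡0 (*-cancelʳ-≈0 ([-1]^-≉0 D) G[D]≈0))
        off : ∀ y → ¬ dist x y ≡ D → G (dist x y) ≈ 0#
        off y d≢D = trans (*-congʳ (trans (+-cong a≈0 a≈0) (+-identityʳ 0#))) (zeroˡ _)
          where
          a≈0 : a (dist x y) ≈ 0#
          a≈0 = reflexive (≡.cong (fromℕ F) (aᵢ≡0 (ℕ.≤∧≢⇒< (dist-≤D x y) d≢D)))

lemma4p5 : ∀ {c ℓ : Level} (F : CommutativeRing c ℓ) → IsFieldChar0 F →
    ∀ {n : ℕ} (Γ : Graph n) (D : ℕ) (p : ℕ → ℕ → ℕ → ℕ) →
    IsDistanceRegular Γ D p → 3 ≤ D →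
    (θ : CommutativeRing.Carrier F) → IsEigenvalue F Γ θ →
    ¬ (CommutativeRing._≈_ F θ (fromℕ F (valency p))) →
    (ClassicalMinusOneType F D p θ
    ⇔ (CommutativeRing._≈_ F θ (CommutativeRing.-_ F (fromℕ F (valency p))) × Bipartite Γ))
lemma4p5 F isField Γ D p dr 3≤D θ (v , (x , vx≉0) , eigen) θ≉k = mk⇔ forward backward
  where
  open CommutativeRing F using (_≈_; -_)
  open StandardSequence F isField Γ D p dr
  open DistanceRegular Γ D p dr using (aᵢ≡0⇒bipartite)

  1≤D : 1 ≤ D
  1≤D = ℕ.≤-trans (s≤s z≤n) 3≤D

  forward : ClassicalMinusOneType F D p θ → θ ≈ - k × Bipartite Γ
  forward classical with classical (standardSequence θ) (standardSequence-isStandard 1≤D θ)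
  ... | γ , step = θ≈-k , aᵢ≡0⇒bipartite all-aᵢ≡0
    where
    open OfClassicalMinusOneType 3≤D (standardSequence-isStandard 1≤D θ) θ≉k step
    all-aᵢ≡0 : ∀ {i} → i ≤ D → aᵢ p i ≡ 0
    all-aᵢ≡0 i≤D with ℕ.m≤n⇒m<n∨m≡n i≤D
    ... | inj₁ i<D    = aᵢ≡0 i<D
    ... | inj₂ ≡.refl = Eigenvectors.LayerSums.a[D]≡0 F isField Γ D p dr v eigen x θ≈-k aᵢ≡0 vx≉0

  backward : θ ≈ - k × Bipartite Γ → ClassicalMinusOneType F D p θ
  backward (θ≈-k , bipartite) = bipartite⇒classicalMinusOneType 1≤D θ≈-k bipartite
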